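{- Let $a=a_1,a_2,\ldots,a_n$ be a feasible sequence. Form the sequence $\hat a=\hat a_2,\hat a_3,\ldots,\hat a_n$ (indexed by $2,\dots,n$) by deleting $a_1$ and adding $1$ to each of the $a_1$ smallest elements among $a_2,\ldots,a_n$ (leaving the other entries unchanged), where $a_i$ is considered smaller than $a_j$ if $a_i<a_j$, or if $a_i=a_j$ and $i<j$. Then $\hat a$ is well defined (i.e. $0\le a_1\le n-1$) and is feasible, that is: $\hat a$ is non-increasing, $\sum_{i=2}^n \hat a_i=0$, and $\sum_{i=2}^k \hat a_i\le (k-1)(n-k)$ for all $2\le k\le n$.
   Context: A non-increasing sequence of integers $c=c_1,c_2,\ldots,c_N$ is called feasible if $\sum_{i=1}^N c_i=0$ and $\sum_{i=1}^k c_i\le k(N-k)$ for all $1\le k\le N$. (For the sequence $\hat a$ of length $N=n-1$ indexed from $2$ to $n$, this is the condition stated in the claim.) -}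

module Defs where

open import Data.Nat using (ℕ; zero; suc; _∸_) renaming (_*_ to _*ℕ_; _≤_ to _≤ℕ_)
open import Data.Integer using (ℤ; +_; _+_; _≤_; _<_; _<?_)
import Data.Integer.Properties as ℤP
open import Data.Fin using (Fin; zero; suc; toℕ) renaming (_<_ to _<F_; _≤_ to _≤F_; _<?_ to _<F?_)
open import Data.List using (List; length; filter; allFin)
open import Data.Product using (_×_)
open import Data.Sum using (_⊎_)
open import Relation.Binary.PropositionalEquality using (_≡_)
open import Relation.Nullary using (Dec; does)
open import Data.Bool using (if_then_else_)
open import Relation.Nullary.Decidable using (_⊎-dec_; _×-dec_)

-- A sequence c_1,...,c_N is a function Fin N → ℤ (index i ↦ c_{i+1}).

sumF : ∀ {N} → (Fin N → ℤ) → ℤ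
sumF {zero}  c = + 0
sumF {suc N} c = c zero + sumF (λ i → c (suc i))

prefixSum : ∀ {N} → (Fin N → ℤ) → ℕ → ℤ
prefixSum {N}     c zero    = + 0
prefixSum {zero}  c (suc k) = + 0
prefixSum {suc N} c (suc k) = c zero + prefixSum (λ i → c (suc i)) k

NonIncreasing : ∀ {N} → (Fin N → ℤ) → Set
NonIncreasing {N} c = (i j : Fin N) → i ≤F j → c j ≤ c i

Feasible : (N : ℕ) → (Fin N → ℤ) → Set
Feasible N c =
  NonIncreasing c ×
  (sumF c ≡ + 0) ×
  ((k : ℕ) → 1 ≤ℕ k → k ≤ℕ N → prefixSum c k ≤ + (k *ℕ (N ∸ k)))

Smaller : ∀ {N} → (Fin N → ℤ) → Fin N → Fin N → Set
Smaller c i j = (c i < c j) ⊎ ((c i ≡ c j) × (i <F j))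

smaller? : ∀ {N} (c : Fin N → ℤ) (i j : Fin N) → Dec (Smaller c i j)
smaller? c i j = (c i <? c j) ⊎-dec ((c i ℤP.≟ c j) ×-dec (i <F? j))

-- rank c j = number of entries strictly smaller than c_j (in the tie-broken order);
-- the t smallest entries are exactly those with rank < t.
rank : ∀ {N} → (Fin N → ℤ) → Fin N → ℕ
rank {N} c j = length (filter (λ i → smaller? c i j) (allFin N))

-- â: delete a_1 and add 1 to each of the a_1 smallest among a_2..a_n.
-- Entry j of the result (Fin m) corresponds to a_{j+2}.
hat : ∀ {m} → (Fin (suc m) → ℤ) → Fin m → ℤ
hat {m} a j =
  if does ((+ rank (λ i → a (suc i)) j) <? a zero)
  then a (suc j) + + 1
  else a (suc j)

-- Write t = a_1, let b = a_2, ..., a_n (so m = n - 1) and let ε mark the t smallest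
-- entries of b, so that â = b + ε.  The bound at k = 1 gives t ≤ m, and b ≤ t with
-- Σ a = 0 gives t ≥ 0.  Ranks in the tie-broken order are a bijection onto {0, ..., m-1},
-- so exactly t entries are marked; marks are closed downwards, which keeps â non-increasing.
-- For the prefix bound put G k = k(m-k) - (â_2 + ... + â_(k+1)).  If all positions after k
-- are incremented, G k ≥ 0 follows from the bound of a at k+1; if none up to k is, from
-- that bound together with b ≤ t.  Otherwise b is constant between the first incremented
-- position i < k and the first position j ≥ k after which all are incremented, so G is
-- concave on [i, j+1] and non-negative at both ends.
module Submission where

open import Defs
open import Data.Nat using (ℕ; suc)
open import Data.Integer using (ℤ; +_; _≤_)
open import Data.Fin using (Fin; zero)
open import Data.Product using (_×_)

open import Data.Bool using (if_then_else_)
open import Data.Fin as Fin using (suc; fromℕ<; punchOut)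
import Data.Fin.Properties as Finₚ
open import Data.Integer as ℤ using (_+_; _-_; _*_; 0ℤ; 1ℤ; _<_; _<?_; +≤+; +<+)
import Data.Integer.Properties as ℤₚ
open import Data.Integer.Tactic.RingSolver using (solve-∀)
open import Data.List using ([]; _∷_; length; filter; allFin)
open import Data.List.Membership.Propositional using (_∈_)
open import Data.List.Membership.Propositional.Properties using (∈-allFin)
import Data.List.Properties as Listₚ
open import Data.List.Relation.Unary.Any as Any using (here; there)
open import Data.Nat as ℕ using (zero; z≤n; s≤s)
import Data.Nat.Properties as ℕₚ
open import Data.Product using (_,_; proj₁; proj₂; ∃-syntax)
open import Data.Sum using (_⊎_; inj₁; inj₂)
open import Function using (_∘_)
open import Function.Definitions using (Injective)
open import Relation.Binary using (tri<; tri≈; tri>)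
open import Relation.Binary.PropositionalEquality
open import Relation.Nullary using (Dec; yes; no; does; ¬_; contradiction)
open import Relation.Unary using (Decidable)

Is01 : ℤ → Set
Is01 x = x ≡ 0ℤ ⊎ x ≡ 1ℤ

Is01⇒0≤ : ∀ {x} → Is01 x → 0ℤ ≤ x
Is01⇒0≤ (inj₁ refl) = +≤+ z≤n
Is01⇒0≤ (inj₂ refl) = +≤+ z≤n

Is01⇒≤1 : ∀ {x} → Is01 x → x ≤ 1ℤ
Is01⇒≤1 (inj₁ refl) = +≤+ z≤n
Is01⇒≤1 (inj₂ refl) = +≤+ (s≤s z≤n)

𝟙 : ∀ {A : Set} → Dec A → ℤ
𝟙 A? = if does A? then 1ℤ else 0ℤ

𝟙-yes : ∀ {A : Set} (A? : Dec A) → A → 𝟙 A? ≡ 1ℤ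
𝟙-yes (yes _) _ = refl
𝟙-yes (no ¬a) a = contradiction a ¬a

𝟙-no : ∀ {A : Set} (A? : Dec A) → ¬ A → 𝟙 A? ≡ 0ℤ
𝟙-no (yes a) ¬a = contradiction a ¬a
𝟙-no (no _)  _  = refl

𝟙≡1⇒ : ∀ {A : Set} (A? : Dec A) → 𝟙 A? ≡ 1ℤ → A
𝟙≡1⇒ (yes a) _  = a
𝟙≡1⇒ (no _)  ()

𝟙-01 : ∀ {A : Set} (A? : Dec A) → Is01 (𝟙 A?)
𝟙-01 (yes _) = inj₂ refl
𝟙-01 (no _)  = inj₁ refl

if-then-+1 : ∀ {A : Set} (A? : Dec A) x → (if does A? then x + 1ℤ else x) ≡ x + 𝟙 A?
if-then-+1 (yes _) x = refl
if-then-+1 (no _)  x = sym (ℤₚ.+-identityʳ x)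

-- Sums and prefix sums

+-interchange : ∀ a b c d → (a + b) + (c + d) ≡ (a + c) + (b + d)
+-interchange = solve-∀

sumF-zero : ∀ {N} {c : Fin N → ℤ} → (∀ i → c i ≡ 0ℤ) → sumF c ≡ 0ℤ
sumF-zero {zero}  _   = refl
sumF-zero {suc N} {c} c≡0 = cong₂ _+_ (c≡0 zero) (sumF-zero {c = c ∘ suc} (c≡0 ∘ suc))

sumF≡prefixSum : ∀ {N} (c : Fin N → ℤ) → sumF c ≡ prefixSum c N
sumF≡prefixSum {zero}  c = refl
sumF≡prefixSum {suc N} c = cong (_+_ (c zero)) (sumF≡prefixSum (c ∘ suc))

prefixSum-+ : ∀ {N} {c d e : Fin N → ℤ} → (∀ i → c i ≡ d i + e i) →
              ∀ k → prefixSum c k ≡ prefixSum d k + prefixSum e k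
prefixSum-+ _ zero = refl
prefixSum-+ {zero} _ (suc k) = refl
prefixSum-+ {suc N} {c} {d} {e} c≡d+e (suc k) =
  trans (cong₂ _+_ (c≡d+e zero) (prefixSum-+ {c = c ∘ suc} {d ∘ suc} {e ∘ suc} (c≡d+e ∘ suc) k))
        (+-interchange (d zero) (e zero) _ _)

sumF-+ : ∀ {N} {c d e : Fin N → ℤ} → (∀ i → c i ≡ d i + e i) → sumF c ≡ sumF d + sumF e
sumF-+ {N} {c} {d} {e} c≡d+e = begin
  sumF c                        ≡⟨ sumF≡prefixSum c ⟩
  prefixSum c N                 ≡⟨ prefixSum-+ c≡d+e N ⟩
  prefixSum d N + prefixSum e N ≡⟨ cong₂ _+_ (sumF≡prefixSum d) (sumF≡prefixSum e) ⟨
  sumF d + sumF e               ∎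
  where open ≡-Reasoning

prefixSum-≤ : ∀ {N} {c : Fin N → ℤ} {u} → (∀ i → c i ≤ u) → ∀ {k} → k ℕ.≤ N → prefixSum c k ≤ + k * u
prefixSum-≤ {u = u} _ {zero} _ = ℤₚ.≤-reflexive (sym (ℤₚ.*-zeroˡ u))
prefixSum-≤ {suc N} {c} {u} c≤u {suc k} (s≤s k≤N) = begin
  c zero + prefixSum (c ∘ suc) k ≤⟨ ℤₚ.+-mono-≤ (c≤u zero) (prefixSum-≤ {c = c ∘ suc} (c≤u ∘ suc) k≤N) ⟩
  u + + k * u                    ≡⟨ distrib u (+ k) ⟩
  + suc k * u                    ∎
  where
  open ℤₚ.≤-Reasoning
  distrib : ∀ u k → u + k * u ≡ (1ℤ + k) * u
  distrib = solve-∀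

-- Positions ≥ N read as 0, so that prefixSum-suc holds without a bound on k.
entry : ∀ {N} → (Fin N → ℤ) → ℕ → ℤ
entry {zero}  c _       = 0ℤ
entry {suc N} c zero    = c zero
entry {suc N} c (suc l) = entry (c ∘ suc) l

prefixSum-suc : ∀ {N} (c : Fin N → ℤ) k → prefixSum c (suc k) ≡ prefixSum c k + entry c k
prefixSum-suc {zero}  c zero    = refl
prefixSum-suc {zero}  c (suc k) = refl
prefixSum-suc {suc N} c zero    = ℤₚ.+-comm (c zero) 0ℤ
prefixSum-suc {suc N} c (suc k) =
  trans (cong (_+_ (c zero)) (prefixSum-suc (c ∘ suc) k)) (sym (ℤₚ.+-assoc (c zero) _ _))

entry-fromℕ< : ∀ {N} (c : Fin N → ℤ) {l} (l<N : l ℕ.< N) → entry c l ≡ c (fromℕ< l<N)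
entry-fromℕ< {suc N} c {zero}  _          = refl
entry-fromℕ< {suc N} c {suc l} (s≤s l<N) = entry-fromℕ< (c ∘ suc) l<N

entry-all : ∀ {N} {P : ℤ → Set} {c : Fin N → ℤ} → P 0ℤ → (∀ i → P (c i)) → ∀ l → P (entry c l)
entry-all {zero}  P0 _  _       = P0
entry-all {suc N} _  Pc zero    = Pc zero
entry-all {suc N} {P} {c} P0 Pc (suc l) = entry-all {P = P} {c ∘ suc} P0 (Pc ∘ suc) l

entry-antitone : ∀ {N} {c : Fin N → ℤ} → NonIncreasing c →
                 ∀ {l l′} → l ℕ.≤ l′ → l′ ℕ.< N → entry c l′ ≤ entry c l
entry-antitone {N} {c} c↓ {l} l≤l′ l′<N =
  subst₂ _≤_ (sym (entry-fromℕ< c l′<N)) (sym (entry-fromℕ< c l<N))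
    (c↓ (fromℕ< l<N) (fromℕ< l′<N) (subst₂ ℕ._≤_ (sym (Finₚ.toℕ-fromℕ< l<N)) (sym (Finₚ.toℕ-fromℕ< l′<N)) l≤l′))
  where
  l<N : l ℕ.< N
  l<N = ℕₚ.≤-<-trans l≤l′ l′<N

pos-*-∸ : ∀ j {k m} → k ℕ.≤ m → + (j ℕ.* (m ℕ.∸ k)) ≡ + j * (+ m - + k)
pos-*-∸ j {k} {m} k≤m = begin
  + (j ℕ.* (m ℕ.∸ k)) ≡⟨ ℤₚ.pos-* j (m ℕ.∸ k) ⟩
  + j * + (m ℕ.∸ k)   ≡⟨ cong (+ j *_) (ℤₚ.≤-⊖ k≤m) ⟨
  + j * (m ℤ.⊖ k)     ≡⟨ cong (+ j *_) (ℤₚ.m-n≡m⊖n m k) ⟨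
  + j * (+ m - + k)   ∎
  where open ≡-Reasoning

-- Ranks in the tie-broken order

module _ {A : Set} {P Q : A → Set} (P? : Decidable P) (Q? : Decidable Q) (P⇒Q : ∀ {x} → P x → Q x) where

  length-filter-mono : ∀ xs → length (filter P? xs) ℕ.≤ length (filter Q? xs)
  length-filter-mono []       = z≤n
  length-filter-mono (x ∷ xs) with P? x | Q? x
  ... | yes _  | yes _  = s≤s (length-filter-mono xs)
  ... | yes px | no ¬qx = contradiction (P⇒Q px) ¬qx
  ... | no _   | yes _  = ℕₚ.m≤n⇒m≤1+n (length-filter-mono xs)
  ... | no _   | no _   = length-filter-mono xs

  length-filter-mono-< : ∀ {x xs} → x ∈ xs → ¬ P x → Q x →
                         length (filter P? xs) ℕ.< length (filter Q? xs)
  length-filter-mono-< {xs = y ∷ xs} (here refl) ¬py qy with P? y | Q? y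
  ... | yes py | _      = contradiction py ¬py
  ... | no _   | yes _  = s≤s (length-filter-mono xs)
  ... | no _   | no ¬qy = contradiction qy ¬qy
  length-filter-mono-< {xs = y ∷ xs} (there x∈xs) ¬px qx with P? y | Q? y
  ... | yes _  | yes _  = s≤s (length-filter-mono-< x∈xs ¬px qx)
  ... | yes py | no ¬qy = contradiction (P⇒Q py) ¬qy
  ... | no _   | yes _  = ℕₚ.m≤n⇒m≤1+n (length-filter-mono-< x∈xs ¬px qx)
  ... | no _   | no _   = length-filter-mono-< x∈xs ¬px qx

injective⇒surjective : ∀ {n} {f : Fin n → Fin n} → Injective _≡_ _≡_ f → ∀ y → ∃[ x ] f x ≡ y
injective⇒surjective {suc n} {f} f-injective y with Finₚ.any? (λ x → f x Fin.≟ y)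
... | yes hit = hit
... | no miss = contradiction (Finₚ.injective⇒≤ punched-injective) ℕₚ.1+n≰n
  where
  punched : Fin (suc n) → Fin n
  punched x = punchOut {i = y} {j = f x} (λ y≡fx → miss (x , sym y≡fx))
  punched-injective : Injective _≡_ _≡_ punched
  punched-injective {x} {x′} = f-injective ∘ Finₚ.punchOut-injective {i = y} {f x} {f x′} _ _

module _ {N} (c : Fin N → ℤ) where

  Smaller-irrefl : ∀ i → ¬ Smaller c i i
  Smaller-irrefl i (inj₁ ci<ci)     = ℤₚ.<-irrefl refl ci<ci
  Smaller-irrefl i (inj₂ (_ , i<i)) = Finₚ.<-irrefl refl i<i

  Smaller-trans : ∀ {i j k} → Smaller c i j → Smaller c j k → Smaller c i k
  Smaller-trans (inj₁ p)       (inj₁ q)       = inj₁ (ℤₚ.<-trans p q)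
  Smaller-trans (inj₁ p)       (inj₂ (q , _)) = inj₁ (ℤₚ.<-≤-trans p (ℤₚ.≤-reflexive q))
  Smaller-trans (inj₂ (p , _)) (inj₁ q)       = inj₁ (ℤₚ.≤-<-trans (ℤₚ.≤-reflexive p) q)
  Smaller-trans (inj₂ (p , i<j)) (inj₂ (q , j<k)) = inj₂ (trans p q , Finₚ.<-trans i<j j<k)

  Smaller-connex : ∀ i j → i ≢ j → Smaller c i j ⊎ Smaller c j i
  Smaller-connex i j i≢j with ℤₚ.<-cmp (c i) (c j)
  ... | tri< ci<cj _ _ = inj₁ (inj₁ ci<cj)
  ... | tri> _ _ cj<ci = inj₂ (inj₁ cj<ci)
  ... | tri≈ _ ci≡cj _ with Finₚ.<-cmp i j
  ...   | tri< i<j _ _ = inj₁ (inj₂ (ci≡cj , i<j))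
  ...   | tri≈ _ i≡j _ = contradiction i≡j i≢j
  ...   | tri> _ _ j<i = inj₂ (inj₂ (sym ci≡cj , j<i))

  rank-< : ∀ j → rank c j ℕ.< N
  rank-< j = subst (rank c j ℕ.<_) (Listₚ.length-tabulate _)
    (Listₚ.filter-notAll (λ i → smaller? c i j) (allFin N)
      (Any.map (λ { refl → Smaller-irrefl j }) (∈-allFin j)))

  rank-mono-< : ∀ {i j} → Smaller c i j → rank c i ℕ.< rank c j
  rank-mono-< {i} {j} i≺j =
    length-filter-mono-< (λ k → smaller? c k i) (λ k → smaller? c k j) (λ k≺i → Smaller-trans k≺i i≺j)
      (∈-allFin i) (Smaller-irrefl i) i≺j

  rank-injective : ∀ {i j} → rank c i ≡ rank c j → i ≡ j
  rank-injective {i} {j} rᵢ≡rⱼ with i Fin.≟ j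
  ... | yes i≡j = i≡j
  ... | no i≢j with Smaller-connex i j i≢j
  ...   | inj₁ i≺j = contradiction rᵢ≡rⱼ (ℕₚ.<⇒≢ (rank-mono-< i≺j))
  ...   | inj₂ j≺i = contradiction (sym rᵢ≡rⱼ) (ℕₚ.<⇒≢ (rank-mono-< j≺i))

  rank-surjective : ∀ {r} → r ℕ.< N → ∃[ j ] rank c j ≡ r
  rank-surjective {r} r<N =
    let j , rⱼ≡r = injective⇒surjective rankFin-injective (fromℕ< r<N)
    in  j , Finₚ.fromℕ<-injective _ _ (rank-< j) r<N rⱼ≡r
    where
    rankFin : Fin N → Fin N
    rankFin j = fromℕ< (rank-< j)
    rankFin-injective : Injective _≡_ _≡_ rankFin
    rankFin-injective {i} {j} = rank-injective ∘ Finₚ.fromℕ<-injective _ _ (rank-< i) (rank-< j)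

markSmallest : ∀ {N} → (Fin N → ℤ) → ℤ → Fin N → ℤ
markSmallest c t j = 𝟙 (+ rank c j <? t)

module _ {N} (c : Fin N → ℤ) (t : ℤ) where

  markSmallest-01 : ∀ j → Is01 (markSmallest c t j)
  markSmallest-01 j = 𝟙-01 (+ rank c j <? t)

  markSmallest-downward : ∀ {i j} → Smaller c j i → markSmallest c t i ≡ 1ℤ → markSmallest c t j ≡ 1ℤ
  markSmallest-downward {i} {j} j≺i marked =
    𝟙-yes (+ rank c j <? t) (ℤₚ.<-trans (+<+ (rank-mono-< c j≺i)) (𝟙≡1⇒ (+ rank c i <? t) marked))

𝟙-<-suc : ∀ r n → 𝟙 (+ r <? + suc n) ≡ 𝟙 (+ r <? + n) + 𝟙 (r ℕ.≟ n)
𝟙-<-suc r n with ℕₚ.<-cmp r n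
... | tri< r<n r≢n _ =
  trans (𝟙-yes (+ r <? + suc n) (+<+ (ℕₚ.m<n⇒m<1+n r<n)))
        (sym (cong₂ _+_ (𝟙-yes (+ r <? + n) (+<+ r<n)) (𝟙-no (r ℕ.≟ n) r≢n)))
... | tri≈ r≮n r≡n _ =
  trans (𝟙-yes (+ r <? + suc n) (+<+ (s≤s (ℕₚ.≤-reflexive r≡n))))
        (sym (cong₂ _+_ (𝟙-no (+ r <? + n) (r≮n ∘ ℤₚ.drop‿+<+)) (𝟙-yes (r ℕ.≟ n) r≡n)))
... | tri> _ r≢n n<r =
  trans (𝟙-no (+ r <? + suc n) (ℕₚ.<⇒≱ n<r ∘ ℕ.s≤s⁻¹ ∘ ℤₚ.drop‿+<+))
        (sym (cong₂ _+_ (𝟙-no (+ r <? + n) (ℕₚ.<-asym n<r ∘ ℤₚ.drop‿+<+)) (𝟙-no (r ℕ.≟ n) r≢n)))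

sumF-𝟙-unique : ∀ {N} {P : Fin N → Set} (P? : Decidable P) {i} → P i → (∀ {j} → P j → j ≡ i) →
                sumF (λ j → 𝟙 (P? j)) ≡ 1ℤ
sumF-𝟙-unique {suc N} P? {zero} p unique =
  cong₂ _+_ (𝟙-yes (P? zero) p) (sumF-zero (λ j → 𝟙-no (P? (suc j)) (Finₚ.0≢1+n ∘ sym ∘ unique)))
sumF-𝟙-unique {suc N} P? {suc i} p unique =
  cong₂ _+_ (𝟙-no (P? zero) (Finₚ.0≢1+n ∘ unique)) (sumF-𝟙-unique (P? ∘ suc) p (Finₚ.suc-injective ∘ unique))

sumF-markSmallest-pos : ∀ {N} (c : Fin N → ℤ) {n} → n ℕ.≤ N → sumF (markSmallest c (+ n)) ≡ + n
sumF-markSmallest-pos c {zero} _ = sumF-zero (λ j → 𝟙-no (+ rank c j <? 0ℤ) λ { (+<+ ()) })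
sumF-markSmallest-pos c {suc n} n<N = begin
  sumF (markSmallest c (+ suc n))                                  ≡⟨ sumF-+ (λ j → 𝟙-<-suc (rank c j) n) ⟩
  sumF (markSmallest c (+ n)) + sumF (λ j → 𝟙 (rank c j ℕ.≟ n))   ≡⟨ cong₂ _+_ count-below-n count-at-n ⟩
  + n + 1ℤ                                                         ≡⟨ cong +_ (ℕₚ.+-comm n 1) ⟩
  + suc n                                                          ∎
  where
  open ≡-Reasoning
  count-below-n : sumF (markSmallest c (+ n)) ≡ + n
  count-below-n = sumF-markSmallest-pos c (ℕₚ.<⇒≤ n<N)
  count-at-n : sumF (λ j → 𝟙 (rank c j ℕ.≟ n)) ≡ 1ℤ
  count-at-n =
    let j₀ , rⱼ₀≡n = rank-surjective c n<N
    in  sumF-𝟙-unique (λ j → rank c j ℕ.≟ n) rⱼ₀≡n (λ rⱼ≡n → rank-injective c (trans rⱼ≡n (sym rⱼ₀≡n)))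

sumF-markSmallest : ∀ {N} (c : Fin N → ℤ) {t} → 0ℤ ≤ t → t ≤ + N → sumF (markSmallest c t) ≡ t
sumF-markSmallest c (+≤+ _) (+≤+ n≤N) = sumF-markSmallest-pos c n≤N

nonIncreasing-+-01 : ∀ {N} {c b e : Fin N → ℤ} → (∀ i → c i ≡ b i + e i) →
                     NonIncreasing b → (∀ i → Is01 (e i)) →
                     (∀ {i j} → Smaller b j i → e i ≡ 1ℤ → e j ≡ 1ℤ) → NonIncreasing c
nonIncreasing-+-01 {c = c} {b} {e} c≡b+e b↓ e-01 e-downward i j i≤j =
  subst₂ _≤_ (sym (c≡b+e j)) (sym (c≡b+e i)) ordered
  where
  open ℤₚ.≤-Reasoning
  ordered : b j + e j ≤ b i + e i
  ordered with b j <? b i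
  ... | yes bⱼ<bᵢ = begin
    b j + e j  ≤⟨ ℤₚ.+-monoʳ-≤ (b j) (Is01⇒≤1 (e-01 j)) ⟩
    b j + 1ℤ   ≡⟨ ℤₚ.+-comm (b j) 1ℤ ⟩
    1ℤ + b j   ≤⟨ ℤₚ.i<j⇒suc[i]≤j bⱼ<bᵢ ⟩
    b i        ≡⟨ ℤₚ.+-identityʳ (b i) ⟨
    b i + 0ℤ   ≤⟨ ℤₚ.+-monoʳ-≤ (b i) (Is01⇒0≤ (e-01 i)) ⟩
    b i + e i  ∎
  ... | no bⱼ≮bᵢ with i Fin.≟ j
  ...   | yes refl = ℤₚ.≤-refl
  ...   | no i≢j = ℤₚ.+-mono-≤ (b↓ i j i≤j) eⱼ≤eᵢ
    where
    eⱼ≤eᵢ : e j ≤ e i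
    eⱼ≤eᵢ with e-01 j
    ... | inj₁ eⱼ≡0 = subst (_≤ e i) (sym eⱼ≡0) (Is01⇒0≤ (e-01 i))
    ... | inj₂ eⱼ≡1 = ℤₚ.≤-reflexive (trans eⱼ≡1 (sym (e-downward i≺j eⱼ≡1)))
      where
      i≺j : Smaller b i j
      i≺j = inj₂ (ℤₚ.≤-antisym (ℤₚ.≮⇒≥ bⱼ≮bᵢ) (b↓ i j i≤j) , Finₚ.≤∧≢⇒< i≤j i≢j)

-- Discrete concavity

Δ : (ℕ → ℤ) → ℕ → ℤ
Δ G l = G (suc l) - G l

module _ (G : ℕ → ℤ) {lo hi : ℕ}
         (concave : ∀ {l} → lo ℕ.≤ l → 2 ℕ.+ l ℕ.≤ hi → Δ G (suc l) ≤ Δ G l) where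

  rising-until : ∀ {k} → lo ℕ.≤ k → suc k ℕ.≤ hi → 0ℤ ≤ Δ G k → G lo ≤ G k
  rising-until {zero}  z≤n    _         _    = ℤₚ.≤-refl
  rising-until {suc k} lo≤1+k 2+k≤hi rise with ℕₚ.m≤n⇒m<n∨m≡n lo≤1+k
  ... | inj₂ refl        = ℤₚ.≤-refl
  ... | inj₁ (s≤s lo≤k) =
    ℤₚ.≤-trans (rising-until lo≤k (ℕₚ.<⇒≤ 2+k≤hi) rise′) (ℤₚ.0≤i-j⇒j≤i rise′)
    where
    rise′ : 0ℤ ≤ Δ G k
    rise′ = ℤₚ.≤-trans rise (concave lo≤k 2+k≤hi)

  falling-from : ∀ {k} d → lo ℕ.≤ k → suc k ℕ.+ d ℕ.≤ hi → Δ G k ≤ 0ℤ → G (suc k ℕ.+ d) ≤ G (suc k)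
  falling-from {k} zero    _    _     _    = ℤₚ.≤-reflexive (cong G (ℕₚ.+-identityʳ (suc k)))
  falling-from {k} (suc d) lo≤k bound fall = begin
    G (suc k ℕ.+ suc d)     ≡⟨ cong G (ℕₚ.+-suc (suc k) d) ⟩
    G (suc (suc k) ℕ.+ d)   ≤⟨ falling-from d (ℕₚ.m≤n⇒m≤1+n lo≤k) bound′ fall′ ⟩
    G (suc (suc k))         ≤⟨ ℤₚ.i-j≤0⇒i≤j fall′ ⟩
    G (suc k)               ∎
    where
    open ℤₚ.≤-Reasoning
    bound′ : suc (suc k) ℕ.+ d ℕ.≤ hi
    bound′ = subst (ℕ._≤ hi) (ℕₚ.+-suc (suc k) d) bound
    fall′ : Δ G (suc k) ≤ 0ℤ
    fall′ = ℤₚ.≤-trans (concave lo≤k (ℕₚ.≤-trans (s≤s (s≤s (ℕₚ.m≤m+n k d))) bound′)) fall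

  concave-nonneg : 0ℤ ≤ G lo → 0ℤ ≤ G hi → ∀ {k} → lo ℕ.≤ k → k ℕ.≤ hi → 0ℤ ≤ G k
  concave-nonneg G-lo G-hi {k} lo≤k k≤hi with ℕₚ.m≤n⇒m<n∨m≡n k≤hi
  ... | inj₂ refl = G-hi
  ... | inj₁ k<hi with 0ℤ ℤ.≤? Δ G k
  ...   | yes rise = ℤₚ.≤-trans G-lo (rising-until lo≤k k<hi rise)
  ...   | no ¬rise = begin
    0ℤ                          ≤⟨ G-hi ⟩
    G hi                        ≡⟨ cong G (ℕₚ.m+[n∸m]≡n k<hi) ⟨
    G (suc k ℕ.+ (hi ℕ.∸ suc k)) ≤⟨ falling-from (hi ℕ.∸ suc k) lo≤k (ℕₚ.≤-reflexive (ℕₚ.m+[n∸m]≡n k<hi)) fall ⟩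
    G (suc k)                   ≤⟨ ℤₚ.i-j≤0⇒i≤j fall ⟩
    G k                         ∎
    where
    open ℤₚ.≤-Reasoning
    fall : Δ G k ≤ 0ℤ
    fall = ℤₚ.<⇒≤ (ℤₚ.≰⇒> ¬rise)

-- Prefix sums after incrementing the smallest entries

module IncrementedPrefixSums
  {m : ℕ} {t : ℤ} {b e : Fin m → ℤ}
  (b↓ : NonIncreasing b)
  (b≤t : ∀ i → b i ≤ t)
  (t+b-bound : ∀ {k} → k ℕ.≤ m → t + prefixSum b k ≤ + suc k * (+ m - + k))
  (e-01 : ∀ i → Is01 (e i))
  (sumF-e : sumF e ≡ t)
  (e-downward : ∀ {i j} → b j < b i → e i ≡ 1ℤ → e j ≡ 1ℤ)
  where

  β ε : ℕ → ℤ
  β = entry b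
  ε = entry e

  G : ℕ → ℤ
  G k = + k * (+ m - + k) - (prefixSum b k + prefixSum e k)

  -- t - prefixSum e k of the increments fall on the m - k positions from k on;
  -- the slack is non-negative exactly when every one of those positions is incremented.
  slack : ℕ → ℤ
  slack k = (t - prefixSum e k) - (+ m - + k)

  ε-01 : ∀ l → Is01 (ε l)
  ε-01 = entry-all {P = Is01} (inj₁ refl) e-01

  ε-downward : ∀ {l l′} → l ℕ.< m → l′ ℕ.< m → β l′ < β l → ε l ≡ 1ℤ → ε l′ ≡ 1ℤ
  ε-downward l<m l′<m βl′<βl εl≡1 =
    trans (entry-fromℕ< e l′<m)
      (e-downward (subst₂ _<_ (entry-fromℕ< b l′<m) (entry-fromℕ< b l<m) βl′<βl)
                  (trans (sym (entry-fromℕ< e l<m)) εl≡1))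

  flat-between : ∀ {i j} → i ℕ.≤ j → j ℕ.< m → ε i ≡ 1ℤ → ε j ≡ 0ℤ →
                 ∀ {l} → i ℕ.≤ l → l ℕ.≤ j → β l ≡ β i
  flat-between {i} {j} i≤j j<m εi≡1 εj≡0 {l} i≤l l≤j =
    ℤₚ.≤-antisym (entry-antitone b↓ i≤l (ℕₚ.≤-<-trans l≤j j<m))
                 (ℤₚ.≤-trans βi≤βj (entry-antitone b↓ l≤j j<m))
    where
    0≢1 : 0ℤ ≢ 1ℤ
    0≢1 ()
    βi≤βj : β i ≤ β j
    βi≤βj = ℤₚ.≮⇒≥ λ βj<βi →
      0≢1 (trans (sym εj≡0) (ε-downward (ℕₚ.≤-<-trans i≤j j<m) j<m βj<βi εi≡1))

  slack-suc : ∀ k → slack (suc k) ≡ slack k + (1ℤ - ε k)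
  slack-suc k = trans (cong (λ x → (t - x) - (+ m - + suc k)) (prefixSum-suc e k))
                      (shift t (prefixSum e k) (ε k) (+ m) (+ k))
    where
    shift : ∀ t x y m k → (t - (x + y)) - (m - (1ℤ + k)) ≡ ((t - x) - (m - k)) + (1ℤ - y)
    shift = solve-∀

  slack-m : slack m ≡ 0ℤ
  slack-m = cong₂ _-_ (trans (cong (t -_) prefixSum-e≡t) (ℤₚ.+-inverseʳ t)) (ℤₚ.+-inverseʳ (+ m))
    where
    prefixSum-e≡t : prefixSum e m ≡ t
    prefixSum-e≡t = trans (sym (sumF≡prefixSum e)) sumF-e

  ΔG≡ : ∀ l → Δ G l ≡ (+ m - + l - + suc l) - (β l + ε l)
  ΔG≡ l = trans (cong₂ (λ x y → (+ suc l * (+ m - + suc l) - (x + y)) - G l)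
                       (prefixSum-suc b l) (prefixSum-suc e l))
                (step (+ l) (+ m) (prefixSum b l) (prefixSum e l) (β l) (ε l))
    where
    step : ∀ l m x y u v →
           ((1ℤ + l) * (m - (1ℤ + l)) - ((x + u) + (y + v))) - (l * (m - l) - (x + y)) ≡
           (m - l - (1ℤ + l)) - (u + v)
    step = solve-∀

  ΔG-antitone : ∀ l → β (suc l) ≡ β l → Δ G (suc l) ≤ Δ G l
  ΔG-antitone l flat = ℤₚ.0≤i-j⇒j≤i (subst (0ℤ ≤_) (sym second-difference) nonneg)
    where
    second-difference : Δ G l - Δ G (suc l) ≡ ε (suc l) + ((1ℤ - ε l) + 1ℤ)
    second-difference =
      trans (cong₂ _-_ (ΔG≡ l) (trans (ΔG≡ (suc l))
                                      (cong (λ x → (+ m - + suc l - + suc (suc l)) - (x + ε (suc l))) flat)))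
            (diff (+ m) (+ l) (β l) (ε l) (ε (suc l)))
      where
      diff : ∀ m l u v w →
             (m - l - (1ℤ + l) - (u + v)) - (m - (1ℤ + l) - (1ℤ + (1ℤ + l)) - (u + w)) ≡
             w + ((1ℤ - v) + 1ℤ)
      diff = solve-∀
    nonneg : 0ℤ ≤ ε (suc l) + ((1ℤ - ε l) + 1ℤ)
    nonneg = ℤₚ.+-mono-≤ (Is01⇒0≤ (ε-01 (suc l)))
               (ℤₚ.+-mono-≤ (ℤₚ.i≤j⇒0≤j-i (Is01⇒≤1 (ε-01 l))) (+≤+ z≤n))

  G-nonneg-if-saturated : ∀ {k} → k ℕ.≤ m → 0ℤ ≤ slack k → 0ℤ ≤ G k
  G-nonneg-if-saturated {k} k≤m saturated =
    subst (0ℤ ≤_) (regroup (+ k) (+ m) t (prefixSum b k) (prefixSum e k))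
      (ℤₚ.+-mono-≤ (ℤₚ.i≤j⇒0≤j-i (t+b-bound k≤m)) saturated)
    where
    regroup : ∀ k m t x y → ((1ℤ + k) * (m - k) - (t + x)) + ((t - y) - (m - k)) ≡ k * (m - k) - (x + y)
    regroup = solve-∀

  G-nonneg-if-unincremented : ∀ {k} → k ℕ.≤ m → prefixSum e k ≡ 0ℤ → 0ℤ ≤ G k
  G-nonneg-if-unincremented {k} k≤m X≡0 with 0ℤ ℤ.≤? slack k
  ... | yes saturated  = G-nonneg-if-saturated k≤m saturated
  ... | no unsaturated =
    subst (0ℤ ≤_) (trans (regroup (+ k) (+ m) t (prefixSum b k))
                         (cong (λ y → + k * (+ m - + k) - (prefixSum b k + y)) (sym X≡0)))
      (ℤₚ.+-mono-≤ k[m-k-t]≥0 (ℤₚ.i≤j⇒0≤j-i (prefixSum-≤ b≤t k≤m)))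
    where
    regroup : ∀ k m t x → k * ((m - k) - t) + (k * t - x) ≡ k * (m - k) - (x + 0ℤ)
    regroup = solve-∀
    t≤m-k : t ≤ + m - + k
    t≤m-k = subst (_≤ + m - + k) (trans (cong (t -_) X≡0) (ℤₚ.+-identityʳ t))
              (ℤₚ.i-j≤0⇒i≤j (ℤₚ.<⇒≤ (ℤₚ.≰⇒> unsaturated)))
    k[m-k-t]≥0 : 0ℤ ≤ + k * ((+ m - + k) - t)
    k[m-k-t]≥0 = subst (_≤ + k * ((+ m - + k) - t)) (ℤₚ.*-zeroʳ (+ k)) (ℤₚ.*-monoˡ-≤-nonNeg (+ k) (ℤₚ.i≤j⇒0≤j-i t≤m-k))

  first-increment : ∀ k → prefixSum e k ≢ 0ℤ → ∃[ i ] i ℕ.< k × ε i ≡ 1ℤ × prefixSum e i ≡ 0ℤ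
  first-increment zero    X≢0 = contradiction refl X≢0
  first-increment (suc k) X≢0 with prefixSum e k ℤ.≟ 0ℤ
  ... | no Xk≢0 = let i , i<k , found = first-increment k Xk≢0 in i , ℕₚ.m<n⇒m<1+n i<k , found
  ... | yes Xk≡0 with ε-01 k
  ...   | inj₂ εk≡1 = k , ℕₚ.n<1+n k , εk≡1 , Xk≡0
  ...   | inj₁ εk≡0 = contradiction (trans (prefixSum-suc e k) (cong₂ _+_ Xk≡0 εk≡0)) X≢0

  first-saturation : ∀ d {k} → k ℕ.+ d ≡ m → slack k < 0ℤ →
                     ∃[ j ] k ℕ.≤ j × j ℕ.< m × ε j ≡ 0ℤ × 0ℤ ≤ slack (suc j)
  first-saturation zero {k} k+0≡m slack<0 =
    contradiction slack-m (ℤₚ.<⇒≢ (subst (λ n → slack n < 0ℤ) (trans (sym (ℕₚ.+-identityʳ k)) k+0≡m) slack<0))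
  first-saturation (suc d) {k} k+1+d≡m slack<0 with 0ℤ ℤ.≤? slack (suc k)
  ... | yes saturated = k , ℕₚ.≤-refl , subst (k ℕ.<_) k+1+d≡m (ℕₚ.m<m+n k (s≤s z≤n)) , εk≡0 , saturated
    where
    εk≡0 : ε k ≡ 0ℤ
    εk≡0 with ε-01 k
    ... | inj₁ εk≡0 = εk≡0
    ... | inj₂ εk≡1 = contradiction saturated (ℤₚ.<⇒≱ (subst (_< 0ℤ) (sym slack-unchanged) slack<0))
      where
      slack-unchanged : slack (suc k) ≡ slack k
      slack-unchanged = trans (slack-suc k)
        (trans (cong (λ x → slack k + (1ℤ - x)) εk≡1) (ℤₚ.+-identityʳ (slack k)))
  ... | no unsaturated =
    let j , k<j , found = first-saturation d (trans (sym (ℕₚ.+-suc k d)) k+1+d≡m) (ℤₚ.≰⇒> unsaturated)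
    in  j , ℕₚ.<⇒≤ k<j , found

  -- b is constant between an incremented position i and a non-incremented j ≥ i,
  -- which makes G concave on [i, j + 1].
  G-nonneg-between : ∀ {i j} → i ℕ.≤ j → j ℕ.< m → ε i ≡ 1ℤ → prefixSum e i ≡ 0ℤ →
                     ε j ≡ 0ℤ → 0ℤ ≤ slack (suc j) → ∀ {k} → i ℕ.≤ k → k ℕ.≤ suc j → 0ℤ ≤ G k
  G-nonneg-between {i} {j} i≤j j<m εi≡1 Xi≡0 εj≡0 saturated =
    concave-nonneg G concave
      (G-nonneg-if-unincremented (ℕₚ.<⇒≤ (ℕₚ.≤-<-trans i≤j j<m)) Xi≡0)
      (G-nonneg-if-saturated j<m saturated)
    where
    flat : ∀ {l} → i ℕ.≤ l → l ℕ.≤ j → β l ≡ β i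
    flat = flat-between i≤j j<m εi≡1 εj≡0
    concave : ∀ {l} → i ℕ.≤ l → 2 ℕ.+ l ℕ.≤ suc j → Δ G (suc l) ≤ Δ G l
    concave {l} i≤l (s≤s 1+l≤j) =
      ΔG-antitone l (trans (flat (ℕₚ.m≤n⇒m≤1+n i≤l) 1+l≤j) (sym (flat i≤l (ℕₚ.<⇒≤ 1+l≤j))))

  prefix-bound : ∀ {k} → k ℕ.≤ m → prefixSum b k + prefixSum e k ≤ + k * (+ m - + k)
  prefix-bound {k} k≤m = ℤₚ.0≤i-j⇒j≤i G-nonneg
    where
    G-nonneg : 0ℤ ≤ G k
    G-nonneg with prefixSum e k ℤ.≟ 0ℤ | 0ℤ ℤ.≤? slack k
    ... | yes X≡0 | _              = G-nonneg-if-unincremented k≤m X≡0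
    ... | no _    | yes saturated  = G-nonneg-if-saturated k≤m saturated
    ... | no X≢0  | no unsaturated =
      let i , i<k , εi≡1 , Xi≡0          = first-increment k X≢0
          j , k≤j , j<m , εj≡0 , sat-j = first-saturation (m ℕ.∸ k) (ℕₚ.m+[n∸m]≡n k≤m) (ℤₚ.≰⇒> unsaturated)
      in  G-nonneg-between (ℕₚ.<⇒≤ (ℕₚ.<-≤-trans i<k k≤j)) j<m εi≡1 Xi≡0 εj≡0 sat-j
            (ℕₚ.<⇒≤ i<k) (ℕₚ.m≤n⇒m≤1+n k≤j)

feasible-head-bounds : ∀ {m} {a : Fin (suc m) → ℤ} → Feasible (suc m) a → (+ 0 ≤ a zero) × (a zero ≤ + m)
feasible-head-bounds {m} {a} (a↓ , sum≡0 , bound) = 0≤a₁ , a₁≤m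
  where
  open ℤₚ.≤-Reasoning
  a₁≤m : a zero ≤ + m
  a₁≤m = subst₂ _≤_ (ℤₚ.+-identityʳ (a zero)) (cong +_ (ℕₚ.*-identityˡ m)) (bound 1 (s≤s z≤n) (s≤s z≤n))
  0≤a₁ : 0ℤ ≤ a zero
  0≤a₁ = ℤₚ.*-cancelˡ-≤-pos 0ℤ (a zero) (+ suc m) (begin
    + suc m * 0ℤ         ≡⟨ ℤₚ.*-zeroʳ (+ suc m) ⟩
    0ℤ                   ≡⟨ sum≡0 ⟨
    sumF a               ≡⟨ sumF≡prefixSum a ⟩
    prefixSum a (suc m)  ≤⟨ prefixSum-≤ (λ i → a↓ zero i z≤n) ℕₚ.≤-refl ⟩
    + suc m * a zero     ∎)

hat≡+markSmallest : ∀ {m} (a : Fin (suc m) → ℤ) j → hat a j ≡ a (suc j) + markSmallest (a ∘ suc) (a zero) j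
hat≡+markSmallest a j = if-then-+1 (+ rank (a ∘ suc) j <? a zero) (a (suc j))

theorem3 : (m : ℕ) (a : Fin (suc m) → ℤ) → Feasible (suc m) a →
    ((+ 0 ≤ a zero) × (a zero ≤ + m)) × Feasible m (hat a)
theorem3 m a feasible@(a↓ , sum≡0 , bound) = head-bounds , hat↓ , sumF-hat , prefixSum-hat
  where
  head-bounds : (+ 0 ≤ a zero) × (a zero ≤ + m)
  head-bounds = feasible-head-bounds feasible
  b↓ : NonIncreasing (a ∘ suc)
  b↓ i j i≤j = a↓ (suc i) (suc j) (s≤s i≤j)
  marks : Fin m → ℤ
  marks = markSmallest (a ∘ suc) (a zero)
  sumF-marks : sumF marks ≡ a zero
  sumF-marks = sumF-markSmallest (a ∘ suc) (proj₁ head-bounds) (proj₂ head-bounds)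
  hat↓ : NonIncreasing (hat a)
  hat↓ = nonIncreasing-+-01 (hat≡+markSmallest a) b↓ (markSmallest-01 (a ∘ suc) (a zero))
           (markSmallest-downward (a ∘ suc) (a zero))
  sumF-hat : sumF (hat a) ≡ 0ℤ
  sumF-hat = begin
    sumF (hat a)                ≡⟨ sumF-+ (hat≡+markSmallest a) ⟩
    sumF (a ∘ suc) + sumF marks ≡⟨ cong (_+_ (sumF (a ∘ suc))) sumF-marks ⟩
    sumF (a ∘ suc) + a zero     ≡⟨ ℤₚ.+-comm _ (a zero) ⟩
    sumF a                      ≡⟨ sum≡0 ⟩
    0ℤ                          ∎
    where open ≡-Reasoning
  open IncrementedPrefixSums b↓ (λ i → a↓ zero (suc i) z≤n)
         (λ {k} k≤m → subst (a zero + prefixSum (a ∘ suc) k ≤_) (pos-*-∸ (suc k) k≤m) (bound (suc k) (s≤s z≤n) (s≤s k≤m)))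
         (markSmallest-01 (a ∘ suc) (a zero)) sumF-marks (markSmallest-downward (a ∘ suc) (a zero) ∘ inj₁)
  prefixSum-hat : ∀ k → 1 ℕ.≤ k → k ℕ.≤ m → prefixSum (hat a) k ≤ + (k ℕ.* (m ℕ.∸ k))
  prefixSum-hat k _ k≤m =
    subst₂ _≤_ (sym (prefixSum-+ (hat≡+markSmallest a) k)) (sym (pos-*-∸ k k≤m)) (prefix-bound k≤m)
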